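{- Let $D=\alpha\boxdot\beta$, $n=|\alpha|+|\beta|$ and $r=\gcd(|\alpha|-m+1,|\beta|-m+1)$. For any $1\le i,j\le n-m$, $i$ and $j$ are equivalent if and only if $i\equiv j\pmod r$ or $i\equiv m-1-j\pmod r$. Consequently, for any equivalence class $[i]$, the set $[i]\cap\{1,2,\dots,r\}$ contains exactly two elements unless $i\equiv m-1-i\pmod r$, in which case $[i]\cap\{1,2,\dots,r\}=\{\min[i]\}$.
   Context: Fix $m\ge2$. For compositions $\alpha=\alpha_1\cdots\alpha_k$ and $\beta=\beta_1\cdots\beta_l$ with $\alpha_k\ge m$, $\beta_1\ge m$, $\alpha\boxdot\beta$ denotes the $m$-regular thickened ribbon with exactly one $2\times m$ block: the skew diagram whose rows from bottom to top have $\alpha_1,\dots,\alpha_k,\beta_1,\dots,\beta_l$ boxes, consecutive rows overlapping in exactly one column except rows $\alpha_k,\beta_1$ which overlap in exactly $m$ columns. $|\alpha|$ denotes the sum of the parts. The equivalence relation on $\{1,2,\dots,n-m\}$ is the smallest equivalence relation such that: (1) $i$ is equivalent to $n-m+1-i$ for $1\le i\le n-m$; (2) $i$ is equivalent to $|\alpha|-i$ for $1\le i\le|\alpha|-1$; (3) $i$ is equivalent to $|\alpha|+n-2m+2-i$ for $|\alpha|-m+2\le i\le n-m$. $[i]$ denotes the equivalence class of $i$. -}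

module Defs where

open import Data.Nat using (ℕ; zero; suc; _+_; _∸_; _≤_; _<_)
open import Data.Nat.GCD using (gcd)
open import Data.Integer using (ℤ; +_) renaming (_-_ to _-ℤ_)
open import Data.Integer.Divisibility using () renaming (_∣_ to _∣ℤ_)
open import Data.List using (List; []; _∷_; _++_; [_])
open import Data.Nat.ListAction using (sum)
open import Data.List.Relation.Unary.All using (All)
open import Data.Product using (Σ; ∃; _×_; _,_)
open import Relation.Binary.PropositionalEquality using (_≡_)

IsComposition : List ℕ → Set
IsComposition α = All (λ p → 1 ≤ p) α

LastPartGe : ℕ → List ℕ → Set
LastPartGe m α = Σ (List ℕ) λ αs → Σ ℕ λ ak → (α ≡ αs ++ [ ak ]) × (m ≤ ak)

FirstPartGe : ℕ → List ℕ → Set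
FirstPartGe m β = Σ ℕ λ b1 → Σ (List ℕ) λ βs → (β ≡ b1 ∷ βs) × (m ≤ b1)

∣_∣c : List ℕ → ℕ
∣ α ∣c = sum α

-- The smallest equivalence relation on {1,…,n-m} generated by (1),(2),(3),
-- where a = |α|.  Equiv m a n i j.
data Equiv (m a n : ℕ) : ℕ → ℕ → Set where
  gen1  : ∀ i → 1 ≤ i → i ≤ n ∸ m → Equiv m a n i (n ∸ m + 1 ∸ i)
  gen2  : ∀ i → 1 ≤ i → i ≤ a ∸ 1 → Equiv m a n i (a ∸ i)
  gen3  : ∀ i → a + 2 ∸ m ≤ i → i ≤ n ∸ m → Equiv m a n i (a + n + 2 ∸ (m + m) ∸ i)
  erefl : ∀ i → 1 ≤ i → i ≤ n ∸ m → Equiv m a n i i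
  esym  : ∀ {i j} → Equiv m a n i j → Equiv m a n j i
  etrans : ∀ {i j k} → Equiv m a n i j → Equiv m a n j k → Equiv m a n i k

_≡_[mod_] : ℤ → ℤ → ℕ → Set
x ≡ y [mod r ] = (+ r) ∣ℤ (x -ℤ y)

-- Write c = m - 1, p = |α| - m + 1 and q = |β| - m + 1, so that r = gcd p q and
-- n - m + 1 = c + p + q.  Each generating relation is a reflection x ↦ s - x, about
-- s = n - m + 1, s = |α| = c + p or s = |α| + n - 2m + 2 = c + 2p + q respectively,
-- and every such centre is ≡ c (mod r); hence equivalent i, j satisfy i ≡ j or i ≡ c - j.
-- Conversely, composing two reflections gives the translations x ↦ x + p and x ↦ x + q,
-- and because p + q ≤ n - m, the subtractive Euclidean algorithm turns these into the
-- translation by gcd p q inside {1, …, n - m} (the argument of the Fine–Wilf theorem);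
-- one further reflection covers i ≡ c - j.  Finally every residue class mod r has exactly
-- one member in {1, …, r}, and the class of i meets exactly the residues of i and c - i.

module Submission where

open import Defs
open import Data.Nat using (ℕ; _+_; _∸_; _≤_)
open import Data.Nat.GCD using (gcd)
open import Data.Integer using (ℤ; +_) renaming (_-_ to _-ℤ_)
open import Data.List using (List)
open import Data.Product using (Σ; _×_)
open import Relation.Binary.PropositionalEquality using (_≡_)
open import Relation.Nullary using (¬_)
open import Data.Sum using (_⊎_)

open import Data.Nat
  using (zero; suc; _*_; _<_; _≤?_; z≤n; s≤s; s≤s⁻¹; z<s; NonZero; ≢-nonZero)
  renaming (∣_-_∣ to ∣_-_∣ℕ)
open import Data.Nat.Properties
open import Data.Nat.Divisibility using (_∣_; divides; _∣0; >⇒∤; ∣⇒≤; ∣m∣n⇒∣m+n)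
open import Data.Nat.GCD
  using (gcd-comm; gcd-identityˡ; gcd-identityʳ; gcd[m,n]∣m; gcd[m,n]∣n; gcd[m,n]≢0; gcd-GCD; module GCD)
open import Data.Nat.Induction using (<-wellFounded)
open import Data.Nat.ListAction using (sum)
open import Data.Nat.ListAction.Properties using (sum-++)
import Data.Nat.Tactic.RingSolver as ℕ-Solver
open import Data.Integer using (_⊖_; ∣_∣; _%ℕ_; _/ℕ_; 1ℤ)
  renaming (_+_ to _+ℤ_; _*_ to _*ℤ_; -_ to -ℤ_)
import Data.Integer.Properties as ℤ
open import Data.Integer.DivMod using (a≡a%ℕn+[a/ℕn]*n; n%ℕd<d)
import Data.Integer.Divisibility.Signed as Signed
import Data.Integer.Tactic.RingSolver as ℤ-Solver
open import Data.List using ([_])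
open import Data.Product using (_,_; proj₁; proj₂)
open import Data.Sum using (inj₁; inj₂)
open import Function using (_∘_)
open import Induction.WellFounded using (Acc; acc)
open import Level using (Level)
open import Relation.Nullary using (Dec; yes; no; contradiction)
open import Relation.Binary.PropositionalEquality
  using (refl; sym; trans; cong; cong₂; subst; module ≡-Reasoning)

m≡n+o⇒m∸o≡n : ∀ {m n o} → m ≡ n + o → m ∸ o ≡ n
m≡n+o⇒m∸o≡n {n = n} {o} refl = m+n∸n≡m n o

[m+n]∸[m∸o]≡o+n : ∀ {m o} n → o ≤ m → (m + n) ∸ (m ∸ o) ≡ o + n
[m+n]∸[m∸o]≡o+n {m} {o} n o≤m = m≡n+o⇒m∸o≡n (begin
  m + n               ≡⟨ cong (_+ n) (m+[n∸m]≡n o≤m) ⟨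
  o + (m ∸ o) + n     ≡⟨ swap o (m ∸ o) n ⟩
  o + n + (m ∸ o)     ∎)
  where
  open ≡-Reasoning
  swap : ∀ a b c → a + b + c ≡ a + c + b
  swap = ℕ-Solver.solve-∀

m∣n∧n<m⇒n≡0 : ∀ {m n} → m ∣ n → n < m → n ≡ 0
m∣n∧n<m⇒n≡0 {n = zero}  _   _   = refl
m∣n∧n<m⇒n≡0 {n = suc _} m∣n n<m = contradiction m∣n (>⇒∤ n<m)

gcd[m,m+n]≡gcd[m,n] : ∀ m n → gcd m (m + n) ≡ gcd m n
gcd[m,m+n]≡gcd[m,n] m n = GCD.unique (gcd-GCD m (m + n)) (GCD.step (gcd-GCD m n))

∣m⊖n∣≡∣m-n∣ : ∀ m n → ∣ m ⊖ n ∣ ≡ ∣ m - n ∣ℕ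
∣m⊖n∣≡∣m-n∣ zero    zero    = refl
∣m⊖n∣≡∣m-n∣ zero    (suc n) = refl
∣m⊖n∣≡∣m-n∣ (suc m) zero    = refl
∣m⊖n∣≡∣m-n∣ (suc m) (suc n) = trans (cong ∣_∣ (ℤ.[1+m]⊖[1+n]≡m⊖n m n)) (∣m⊖n∣≡∣m-n∣ m n)

∣+m-+n∣≡∣m-n∣ : ∀ m n → ∣ + m -ℤ + n ∣ ≡ ∣ m - n ∣ℕ
∣+m-+n∣≡∣m-n∣ m n = trans (cong ∣_∣ (ℤ.[+m]-[+n]≡m⊖n m n)) (∣m⊖n∣≡∣m-n∣ m n)

-- A record rather than a synonym for x ≡ y [mod r ], so that x and y can be
-- recovered from a proof by unification.
record Congruent (r : ℕ) (x y : ℤ) : Set where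
  constructor congruent
  field ≡[mod] : x ≡ y [mod r ]

open Congruent public

module _ {r : ℕ} where

  Congruent⇒Signed∣ : ∀ {x y} → Congruent r x y → (+ r) Signed.∣ (x -ℤ y)
  Congruent⇒Signed∣ {x} {y} (congruent x≡y) = Signed.∣ᵤ⇒∣ {+ r} {x -ℤ y} x≡y

  Signed∣⇒Congruent : ∀ {x y} → (+ r) Signed.∣ (x -ℤ y) → Congruent r x y
  Signed∣⇒Congruent {x} {y} r∣x-y = congruent (Signed.∣⇒∣ᵤ {+ r} {x -ℤ y} r∣x-y)

  Congruent⇒∣∣m-n∣ : ∀ {m n} → Congruent r (+ m) (+ n) → r ∣ ∣ m - n ∣ℕ
  Congruent⇒∣∣m-n∣ {m} {n} (congruent r∣m-n) = subst (r ∣_) (∣+m-+n∣≡∣m-n∣ m n) r∣m-n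

  ≡⇒Congruent : ∀ {x y} → x ≡ y → Congruent r x y
  ≡⇒Congruent {x} refl = congruent (subst (r ∣_) (sym (cong ∣_∣ (ℤ.+-inverseʳ x))) (r ∣0))

  Congruent-refl : ∀ {x} → Congruent r x x
  Congruent-refl = ≡⇒Congruent refl

  Congruent-sym : ∀ {x y} → Congruent r x y → Congruent r y x
  Congruent-sym {x} {y} (congruent r∣x-y) = congruent (subst (r ∣_) (ℤ.∣i-j∣≡∣j-i∣ x y) r∣x-y)

  Congruent-trans : ∀ {x y z} → Congruent r x y → Congruent r y z → Congruent r x z
  Congruent-trans {x} {y} {z} x≡y y≡z =
    Signed∣⇒Congruent (subst (_ Signed.∣_) (split x y z)
      (Signed.∣m∣n⇒∣m+n (Congruent⇒Signed∣ x≡y) (Congruent⇒Signed∣ y≡z)))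
    where
    split : ∀ x y z → (x -ℤ y) +ℤ (y -ℤ z) ≡ x -ℤ z
    split = ℤ-Solver.solve-∀

  reflect-cong : ∀ c {x y} → Congruent r x y → Congruent r (c -ℤ x) (c -ℤ y)
  reflect-cong c {x} {y} x≡y =
    Signed∣⇒Congruent (subst (_ Signed.∣_) (negate c x y) (Signed.∣m⇒∣-m (Congruent⇒Signed∣ x≡y)))
    where
    negate : ∀ c x y → -ℤ (x -ℤ y) ≡ (c -ℤ x) -ℤ (c -ℤ y)
    negate = ℤ-Solver.solve-∀

  reflect-sym : ∀ c {x y} → Congruent r x (c -ℤ y) → Congruent r y (c -ℤ x)
  reflect-sym c {x} {y} x≡c-y =
    Congruent-trans (≡⇒Congruent (involutive c y)) (reflect-cong c (Congruent-sym x≡c-y))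
    where
    involutive : ∀ c y → y ≡ c -ℤ (c -ℤ y)
    involutive = ℤ-Solver.solve-∀

reflection : ∀ {r x y c d} → x + y ≡ c + d → r ∣ d → Congruent r (+ x) (+ c -ℤ + y)
reflection {r} {x} {y} {c} {d} x+y≡c+d r∣d = congruent (subst (r ∣_) (cong ∣_∣ (sym difference)) r∣d)
  where
  open ≡-Reasoning
  regroup : ∀ x y c → x -ℤ (c -ℤ y) ≡ (x +ℤ y) -ℤ c
  regroup = ℤ-Solver.solve-∀
  cancel : ∀ c d → (c +ℤ d) -ℤ c ≡ d
  cancel = ℤ-Solver.solve-∀
  difference : + x -ℤ (+ c -ℤ + y) ≡ + d
  difference = begin
    + x -ℤ (+ c -ℤ + y)     ≡⟨ regroup (+ x) (+ y) (+ c) ⟩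
    (+ x +ℤ + y) -ℤ + c     ≡⟨ cong (λ s → + s -ℤ + c) x+y≡c+d ⟩
    (+ c +ℤ + d) -ℤ + c     ≡⟨ cancel (+ c) (+ d) ⟩
    + d                     ∎

data _≈⟨_,_⟩_ (x : ℤ) (r : ℕ) (c : ℤ) (y : ℤ) : Set where
  straight  : Congruent r x y → x ≈⟨ r , c ⟩ y
  reflected : Congruent r x (c -ℤ y) → x ≈⟨ r , c ⟩ y

module _ {r : ℕ} {c : ℤ} where

  ≈-refl : ∀ {x} → x ≈⟨ r , c ⟩ x
  ≈-refl = straight Congruent-refl

  ≈-sym : ∀ {x y} → x ≈⟨ r , c ⟩ y → y ≈⟨ r , c ⟩ x
  ≈-sym (straight x≡y)    = straight (Congruent-sym x≡y)
  ≈-sym (reflected x≡c-y) = reflected (reflect-sym c x≡c-y)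

  ≈-trans : ∀ {x y z} → x ≈⟨ r , c ⟩ y → y ≈⟨ r , c ⟩ z → x ≈⟨ r , c ⟩ z
  ≈-trans (straight x≡y)    (straight y≡z)    = straight (Congruent-trans x≡y y≡z)
  ≈-trans (straight x≡y)    (reflected y≡c-z) = reflected (Congruent-trans x≡y y≡c-z)
  ≈-trans (reflected x≡c-y) (straight y≡z)    = reflected (Congruent-trans x≡c-y (reflect-cong c y≡z))
  ≈-trans (reflected x≡c-y) (reflected y≡c-z) =
    straight (Congruent-trans x≡c-y (Congruent-sym (reflect-sym c y≡c-z)))

≈⇒⊎ : ∀ {x r c y} → x ≈⟨ r , c ⟩ y → (x ≡ y [mod r ]) ⊎ (x ≡ c -ℤ y [mod r ])
≈⇒⊎ (straight (congruent x≡y))    = inj₁ x≡y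
≈⇒⊎ (reflected (congruent x≡c-y)) = inj₂ x≡c-y

⊎⇒≈ : ∀ {x r c y} → (x ≡ y [mod r ]) ⊎ (x ≡ c -ℤ y [mod r ]) → x ≈⟨ r , c ⟩ y
⊎⇒≈ (inj₁ x≡y)   = straight (congruent x≡y)
⊎⇒≈ (inj₂ x≡c-y) = reflected (congruent x≡c-y)

module _ (r : ℕ) .{{_ : NonZero r}} where

  representative : ℤ → ℕ
  representative z = suc ((z -ℤ 1ℤ) %ℕ r)

  representative-≤ : ∀ z → representative z ≤ r
  representative-≤ z = n%ℕd<d (z -ℤ 1ℤ) r

  Congruent-representative : ∀ z → Congruent r z (+ representative z)
  Congruent-representative z = Signed∣⇒Congruent (Signed.divides ((z -ℤ 1ℤ) /ℕ r) (begin
    z -ℤ + representative z        ≡⟨ shift z (+ ρ) ⟩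
    (z -ℤ 1ℤ) -ℤ + ρ               ≡⟨ cong (_-ℤ + ρ) (a≡a%ℕn+[a/ℕn]*n (z -ℤ 1ℤ) r) ⟩
    (+ ρ +ℤ q *ℤ + r) -ℤ + ρ       ≡⟨ cancel (+ ρ) (q *ℤ + r) ⟩
    q *ℤ + r                       ∎))
    where
    open ≡-Reasoning
    ρ : ℕ
    ρ = (z -ℤ 1ℤ) %ℕ r
    q : ℤ
    q = (z -ℤ 1ℤ) /ℕ r
    shift : ∀ z ρ → z -ℤ (1ℤ +ℤ ρ) ≡ (z -ℤ 1ℤ) -ℤ ρ
    shift = ℤ-Solver.solve-∀
    cancel : ∀ ρ t → (ρ +ℤ t) -ℤ ρ ≡ t
    cancel = ℤ-Solver.solve-∀

  Congruent⇒≡ : ∀ {j l} → 1 ≤ j → j ≤ r → 1 ≤ l → l ≤ r → Congruent r (+ j) (+ l) → j ≡ l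
  Congruent⇒≡ {suc j} {suc l} _ j<r _ l<r j≡l =
    cong suc (∣m-n∣≡0⇒m≡n (m∣n∧n<m⇒n≡0 (Congruent⇒∣∣m-n∣ j≡l)
      (≤-<-trans (∣m-n∣≤m⊔n j l) (⊔-lub j<r l<r))))

TwoRepresentatives : ℕ → (ℕ → ℕ → Set) → ℕ → Set
TwoRepresentatives r _~_ i =
  Σ ℕ λ j → Σ ℕ λ k → ¬ (j ≡ k)
    × (1 ≤ j) × (j ≤ r) × i ~ j
    × (1 ≤ k) × (k ≤ r) × i ~ k
    × ((l : ℕ) → 1 ≤ l → l ≤ r → i ~ l → (l ≡ j) ⊎ (l ≡ k))

UniqueRepresentative : ℕ → (ℕ → ℕ → Set) → ℕ → Set
UniqueRepresentative r _~_ i =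
  Σ ℕ λ j → (1 ≤ j) × (j ≤ r) × i ~ j
    × ((l : ℕ) → i ~ l → j ≤ l)
    × ((l : ℕ) → 1 ≤ l → l ≤ r → i ~ l → l ≡ j)

module Representatives {_~_ : ℕ → ℕ → Set} (r : ℕ) .{{_ : NonZero r}} (c : ℤ) (N : ℕ) (r≤N : r ≤ N)
  (~⇒≈ : ∀ {i j} → i ~ j → (+ i) ≈⟨ r , c ⟩ (+ j))
  (≈⇒~ : ∀ {i j} → 1 ≤ i → i ≤ N → 1 ≤ j → j ≤ N → (+ i) ≈⟨ r , c ⟩ (+ j) → i ~ j)
  (~-positive : ∀ {i j} → i ~ j → 1 ≤ j)
  where

  private
    ~-representative : ∀ {i} z → 1 ≤ i → i ≤ N →
                       (+ i) ≈⟨ r , c ⟩ (+ representative r z) → i ~ representative r z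
    ~-representative z 1≤i i≤N = ≈⇒~ 1≤i i≤N (s≤s z≤n) (≤-trans (representative-≤ r z) r≤N)

    ≡representative : ∀ {l} z → 1 ≤ l → l ≤ r → Congruent r (+ l) z → l ≡ representative r z
    ≡representative z 1≤l l≤r l≡z =
      Congruent⇒≡ r 1≤l l≤r (s≤s z≤n) (representative-≤ r z) (Congruent-trans l≡z (Congruent-representative r z))

  two-representatives : ∀ {i} → 1 ≤ i → i ≤ N → ¬ Congruent r (+ i) (c -ℤ + i) →
                        TwoRepresentatives r _~_ i
  two-representatives {i} 1≤i i≤N i≢c-i =
    j , k , j≢k , s≤s z≤n , representative-≤ r (+ i) , i~j ,
    s≤s z≤n , representative-≤ r (c -ℤ + i) , i~k , only-j-k
    where
    j k : ℕ
    j = representative r (+ i)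
    k = representative r (c -ℤ + i)
    i≡j : Congruent r (+ i) (+ j)
    i≡j = Congruent-representative r (+ i)
    i≡c-k : Congruent r (+ i) (c -ℤ + k)
    i≡c-k = reflect-sym c (Congruent-sym (Congruent-representative r (c -ℤ + i)))
    i~j : i ~ j
    i~j = ~-representative (+ i) 1≤i i≤N (straight i≡j)
    i~k : i ~ k
    i~k = ~-representative (c -ℤ + i) 1≤i i≤N (reflected i≡c-k)
    j≢k : ¬ (j ≡ k)
    j≢k j≡k = i≢c-i (Congruent-trans i≡c-k (reflect-cong c (Congruent-sym i≡k)))
      where
      i≡k : Congruent r (+ i) (+ k)
      i≡k = subst (λ t → Congruent r (+ i) (+ t)) j≡k i≡j
    only-j-k : (l : ℕ) → 1 ≤ l → l ≤ r → i ~ l → (l ≡ j) ⊎ (l ≡ k)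
    only-j-k l 1≤l l≤r i~l with ~⇒≈ i~l
    ... | straight i≡l    = inj₁ (≡representative (+ i) 1≤l l≤r (Congruent-sym i≡l))
    ... | reflected i≡c-l = inj₂ (≡representative (c -ℤ + i) 1≤l l≤r (reflect-sym c i≡c-l))

  unique-representative : ∀ {i} → 1 ≤ i → i ≤ N → Congruent r (+ i) (c -ℤ + i) →
                          UniqueRepresentative r _~_ i
  unique-representative {i} 1≤i i≤N i≡c-i =
    j , s≤s z≤n , representative-≤ r (+ i) , i~j , minimal , only-j
    where
    j : ℕ
    j = representative r (+ i)
    i~j : i ~ j
    i~j = ~-representative (+ i) 1≤i i≤N (straight (Congruent-representative r (+ i)))
    l≡i : ∀ {l} → i ~ l → Congruent r (+ l) (+ i)
    l≡i i~l with ~⇒≈ i~l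
    ... | straight i≡l    = Congruent-sym i≡l
    ... | reflected i≡c-l = Congruent-trans (reflect-sym c i≡c-l) (Congruent-sym i≡c-i)
    only-j : (l : ℕ) → 1 ≤ l → l ≤ r → i ~ l → l ≡ j
    only-j l 1≤l l≤r i~l = ≡representative (+ i) 1≤l l≤r (l≡i i~l)
    minimal : (l : ℕ) → i ~ l → j ≤ l
    minimal l i~l with l ≤? r
    ... | yes l≤r = ≤-reflexive (sym (only-j l (~-positive i~l) l≤r i~l))
    ... | no  l≰r = ≤-trans (representative-≤ r (+ i)) (<⇒≤ (≰⇒> l≰r))

module Translations {ℓ : Level} {_~_ : ℕ → ℕ → Set ℓ} (N : ℕ)
  (~-refl : ∀ x → 1 ≤ x → x ≤ N → x ~ x)
  (~-sym : ∀ {x y} → x ~ y → y ~ x)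
  (~-trans : ∀ {x y z} → x ~ y → y ~ z → x ~ z)
  where

  Step : ℕ → Set ℓ
  Step d = ∀ x → 1 ≤ x → x + d ≤ N → x ~ (x + d)

  Step-* : ∀ {d} → Step d → ∀ k → Step (k * d)
  Step-* {d} _ zero x 1≤x x≤N =
    subst (x ~_) (sym (+-identityʳ x)) (~-refl x 1≤x (subst (_≤ N) (+-identityʳ x) x≤N))
  Step-* {d} step (suc k) x 1≤x x+[d+kd]≤N =
    ~-trans (step x 1≤x (≤-trans (+-monoʳ-≤ x (m≤m+n d (k * d))) x+[d+kd]≤N))
      (subst ((x + d) ~_) (+-assoc x d (k * d))
        (Step-* step k (x + d) (≤-trans 1≤x (m≤m+n x d))
          (subst (_≤ N) (sym (+-assoc x d (k * d))) x+[d+kd]≤N)))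

  -- x + d is reached either via x + (p + d) or, when that overflows, via x ∸ p.
  Step-difference : ∀ p d → p + (p + d) ≤ N → Step p → Step (p + d) → Step d
  Step-difference p d bound step-p step-p+d x 1≤x x+d≤N = by-cases (x + (p + d) ≤? N)
    where
    by-cases : Dec (x + (p + d) ≤ N) → x ~ (x + d)
    by-cases (yes x+[p+d]≤N) =
      ~-trans (step-p+d x 1≤x x+[p+d]≤N)
        (~-sym (subst ((x + d) ~_) x+d+p≡x+[p+d]
          (step-p (x + d) (≤-trans 1≤x (m≤m+n x d)) (subst (_≤ N) (sym x+d+p≡x+[p+d]) x+[p+d]≤N))))
      where
      x+d+p≡x+[p+d] : x + d + p ≡ x + (p + d)
      x+d+p≡x+[p+d] = trans (+-assoc x d p) (cong (λ t → x + t) (+-comm d p))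
    by-cases (no x+[p+d]≰N) =
      ~-trans (~-sym (subst (y ~_) y+p≡x (step-p y 1≤y (subst (_≤ N) (sym y+p≡x) x≤N))))
        (subst (y ~_) y+[p+d]≡x+d (step-p+d y 1≤y (subst (_≤ N) (sym y+[p+d]≡x+d) x+d≤N)))
      where
      p<x : p < x
      p<x = +-cancelʳ-< (p + d) p x (≤-<-trans bound (≰⇒> x+[p+d]≰N))
      y : ℕ
      y = x ∸ p
      1≤y : 1 ≤ y
      1≤y = m<n⇒0<n∸m p<x
      y+p≡x : y + p ≡ x
      y+p≡x = m∸n+n≡m (<⇒≤ p<x)
      x≤N : x ≤ N
      x≤N = ≤-trans (m≤m+n x d) x+d≤N
      y+[p+d]≡x+d : y + (p + d) ≡ x + d
      y+[p+d]≡x+d = trans (sym (+-assoc y p d)) (cong (_+ d) y+p≡x)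

  Step-gcd : ∀ p q → p + q ≤ N → Step p → Step q → Step (gcd p q)
  Step-gcd p q = euclid p q (<-wellFounded (p + q))
    where
    euclid : ∀ p q → Acc _<_ (p + q) → p + q ≤ N → Step p → Step q → Step (gcd p q)
    euclid zero q _ _ _ step-q = subst Step (sym (gcd-identityˡ q)) step-q
    euclid p@(suc _) zero _ _ step-p _ = subst Step (sym (gcd-identityʳ p)) step-p
    euclid p@(suc _) q@(suc _) (acc rec) bound step-p step-q with ≤-total p q
    ... | inj₁ p≤q with m≤n⇒∃[o]m+o≡n p≤q
    ...   | d , refl =
      subst Step (sym (gcd[m,m+n]≡gcd[m,n] p d))
        (euclid p d (rec (m<n+m (p + d) z<s)) (≤-trans (m≤n+m (p + d) p) bound)
          step-p (Step-difference p d bound step-p step-q))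
    euclid p@(suc _) q@(suc _) (acc rec) bound step-p step-q | inj₂ q≤p with m≤n⇒∃[o]m+o≡n q≤p
    ...   | d , refl =
      subst Step (sym (trans (gcd-comm (q + d) q) (gcd[m,m+n]≡gcd[m,n] q d)))
        (euclid q d (rec (m<m+n (q + d) z<s)) (≤-trans (m≤m+n (q + d) q) bound)
          step-q (Step-difference q d (subst (_≤ N) (+-comm (q + d) q) bound) step-q step-p))

  Step⇒~-≤ : ∀ {d} → Step d → ∀ {x y} → 1 ≤ x → y ≤ N → x ≤ y → d ∣ y ∸ x → x ~ y
  Step⇒~-≤ {d} step {x} {y} 1≤x y≤N x≤y (divides k y∸x≡kd) =
    subst (x ~_) x+kd≡y (Step-* step k x 1≤x (subst (_≤ N) (sym x+kd≡y) y≤N))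
    where
    x+kd≡y : x + k * d ≡ y
    x+kd≡y = trans (cong (λ t → x + t) (sym y∸x≡kd)) (m+[n∸m]≡n x≤y)

  Step⇒~ : ∀ {d} → Step d → ∀ {x y} → 1 ≤ x → x ≤ N → 1 ≤ y → y ≤ N →
           d ∣ ∣ x - y ∣ℕ → x ~ y
  Step⇒~ {d} step {x} {y} 1≤x x≤N 1≤y y≤N d∣∣x-y∣ with ≤-total x y
  ... | inj₁ x≤y = Step⇒~-≤ step 1≤x y≤N x≤y (subst (d ∣_) (m≤n⇒∣m-n∣≡n∸m x≤y) d∣∣x-y∣)
  ... | inj₂ y≤x = ~-sym (Step⇒~-≤ step 1≤y x≤N y≤x (subst (d ∣_) (m≤n⇒∣n-m∣≡n∸m y≤x) d∣∣x-y∣))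

module Ribbon (k a' b' : ℕ) where

  m c a b n N T p q r : ℕ
  m = 2 + k
  c = 1 + k
  a = m + a'
  b = m + b'
  n = a + b
  N = n ∸ m
  T = a + n + 2 ∸ (m + m)
  p = 1 + a'
  q = 1 + b'
  r = gcd (a + 1 ∸ m) (b + 1 ∸ m)

  _~_ : ℕ → ℕ → Set
  _~_ = Equiv m a n

  N≡a+b' : N ≡ a + b'
  N≡a+b' = m≡n+o⇒m∸o≡n (lemma k a' b')
    where
    lemma : ∀ k a' b' → 2 + k + a' + (2 + k + b') ≡ 2 + k + a' + b' + (2 + k)
    lemma = ℕ-Solver.solve-∀

  N+1≡a+q : N + 1 ≡ a + q
  N+1≡a+q = trans (cong (_+ 1) N≡a+b') (trans (+-assoc a b' 1) (cong (λ t → a + t) (+-comm b' 1)))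

  a≡c+p : a ≡ c + p
  a≡c+p = sym (+-suc (1 + k) a')

  T≡N+1+p : T ≡ N + 1 + p
  T≡N+1+p = m≡n+o⇒m∸o≡n (trans (lemma k a' b') (cong (λ t → t + 1 + p + (m + m)) (sym N≡a+b')))
    where
    lemma : ∀ k a' b' → 2 + k + a' + (2 + k + a' + (2 + k + b')) + 2
                      ≡ 2 + k + a' + b' + 1 + (1 + a') + (2 + k + (2 + k))
    lemma = ℕ-Solver.solve-∀

  a+2∸m≡1+p : a + 2 ∸ m ≡ 1 + p
  a+2∸m≡1+p = m≡n+o⇒m∸o≡n (lemma k a')
    where
    lemma : ∀ k a' → 2 + k + a' + 2 ≡ 2 + a' + (2 + k)
    lemma = ℕ-Solver.solve-∀

  +1∸m-cancel : ∀ x → m + x + 1 ∸ m ≡ 1 + x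
  +1∸m-cancel x = m≡n+o⇒m∸o≡n (lemma k x)
    where
    lemma : ∀ k x → 2 + k + x + 1 ≡ 1 + x + (2 + k)
    lemma = ℕ-Solver.solve-∀

  r≡gcd[p,q] : r ≡ gcd p q
  r≡gcd[p,q] = cong₂ gcd (+1∸m-cancel a') (+1∸m-cancel b')

  instance
    r-nonZero : NonZero r
    r-nonZero = ≢-nonZero (λ r≡0 → gcd[m,n]≢0 p q (inj₁ (λ ())) (trans (sym r≡gcd[p,q]) r≡0))

  r∣p : r ∣ p
  r∣p = subst (_∣ p) (sym r≡gcd[p,q]) (gcd[m,n]∣m p q)

  r∣q : r ∣ q
  r∣q = subst (_∣ q) (sym r≡gcd[p,q]) (gcd[m,n]∣n p q)

  a≤N : a ≤ N
  a≤N = subst (a ≤_) (sym N≡a+b') (m≤m+n a b')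

  p+q≤N : p + q ≤ N
  p+q≤N = subst (p + q ≤_) (sym (trans N≡a+b' (lemma k a' b'))) (m≤m+n (p + q) k)
    where
    lemma : ∀ k a' b' → 2 + k + a' + b' ≡ 1 + a' + (1 + b') + k
    lemma = ℕ-Solver.solve-∀

  x<N+1 : ∀ {x} → x ≤ N → x < N + 1
  x<N+1 {x} x≤N = ≤-trans (s≤s x≤N) (≤-reflexive (+-comm 1 N))

  N+1∸x≤N : ∀ {x} → 1 ≤ x → N + 1 ∸ x ≤ N
  N+1∸x≤N {x} 1≤x = subst (N + 1 ∸ x ≤_) (m+n∸n≡m N 1) (∸-monoʳ-≤ (N + 1) 1≤x)

  reflect : ∀ {x s d} → x ≤ s → s ≡ c + d → r ∣ d → Congruent r (+ x) (+ c -ℤ + (s ∸ x))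
  reflect x≤s s≡c+d r∣d = reflection (trans (m+[n∸m]≡n x≤s) s≡c+d) r∣d

  reflect-N+1 : ∀ {x} → x ≤ N → Congruent r (+ x) (+ c -ℤ + (N + 1 ∸ x))
  reflect-N+1 x≤N = reflect (<⇒≤ (x<N+1 x≤N))
    (trans N+1≡a+q (trans (cong (_+ q) a≡c+p) (+-assoc c p q))) (∣m∣n⇒∣m+n r∣p r∣q)

  ~⇒≈ : ∀ {i j} → i ~ j → (+ i) ≈⟨ r , + c ⟩ (+ j)
  ~⇒≈ (gen1 i _ i≤N) = reflected (reflect-N+1 i≤N)
  ~⇒≈ (gen2 i _ i≤a∸1) = reflected (reflect (≤-trans i≤a∸1 (m∸n≤m a 1)) a≡c+p r∣p)
  ~⇒≈ (gen3 i _ i≤N) =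
    reflected (reflect i≤T T≡c+[p+[p+q]] (∣m∣n⇒∣m+n r∣p (∣m∣n⇒∣m+n r∣p r∣q)))
    where
    i≤T : i ≤ T
    i≤T = ≤-trans (<⇒≤ (x<N+1 i≤N)) (subst (N + 1 ≤_) (sym T≡N+1+p) (m≤m+n (N + 1) p))
    T≡c+[p+[p+q]] : T ≡ c + (p + (p + q))
    T≡c+[p+[p+q]] = trans T≡N+1+p (trans (cong (_+ p) (trans N+1≡a+q (cong (_+ q) a≡c+p))) (lemma c p q))
      where
      lemma : ∀ c p q → c + p + q + p ≡ c + (p + (p + q))
      lemma = ℕ-Solver.solve-∀
  ~⇒≈ (erefl _ _ _) = ≈-refl
  ~⇒≈ (esym i~j) = ≈-sym (~⇒≈ i~j)
  ~⇒≈ (etrans i~j j~l) = ≈-trans (~⇒≈ i~j) (~⇒≈ j~l)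

  ~-positive : ∀ {i j} → i ~ j → 1 ≤ i × 1 ≤ j
  ~-positive (gen1 i 1≤i i≤N) = 1≤i , m<n⇒0<n∸m (x<N+1 i≤N)
  ~-positive (gen2 i 1≤i i≤a∸1) = 1≤i , m<n⇒0<n∸m (s≤s i≤a∸1)
  ~-positive (gen3 i p+1≤i i≤N) =
    ≤-trans (s≤s z≤n) (subst (_≤ i) a+2∸m≡1+p p+1≤i) ,
    m<n⇒0<n∸m (≤-trans (x<N+1 i≤N) (subst (N + 1 ≤_) (sym T≡N+1+p) (m≤m+n (N + 1) p)))
  ~-positive (erefl _ 1≤i _) = 1≤i , 1≤i
  ~-positive (esym i~j) = proj₂ (~-positive i~j) , proj₁ (~-positive i~j)
  ~-positive (etrans i~j j~l) = proj₁ (~-positive i~j) , proj₂ (~-positive j~l)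

  open Translations {_~_ = _~_} N erefl esym etrans

  step-p : Step p
  step-p x 1≤x x+p≤N =
    etrans (gen1 x 1≤x x≤N) (subst (y ~_) T∸y≡x+p (gen3 y a+2∸m≤y (N+1∸x≤N 1≤x)))
    where
    x≤N : x ≤ N
    x≤N = ≤-trans (m≤m+n x p) x+p≤N
    y : ℕ
    y = N + 1 ∸ x
    a+2∸m≤y : a + 2 ∸ m ≤ y
    a+2∸m≤y = subst (_≤ y) (sym a+2∸m≡1+p)
      (m+n≤o⇒m≤o∸n (1 + p)
        (subst (_≤ N + 1) (trans (+-comm (x + p) 1) (cong suc (+-comm x p))) (+-monoˡ-≤ 1 x+p≤N)))
    T∸y≡x+p : T ∸ y ≡ x + p
    T∸y≡x+p = trans (cong (_∸ y) T≡N+1+p) ([m+n]∸[m∸o]≡o+n p (<⇒≤ (x<N+1 x≤N)))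

  step-q : Step q
  step-q x 1≤x x+q≤N =
    etrans (gen2 x 1≤x (s≤s⁻¹ x<a))
      (subst (y ~_) N+1∸y≡x+q (gen1 y (m<n⇒0<n∸m x<a) (≤-trans (m∸n≤m a x) a≤N)))
    where
    x<a : x < a
    x<a = +-cancelʳ-≤ q (suc x) a
      (subst (suc x + q ≤_) N+1≡a+q (subst (_≤ N + 1) (+-comm (x + q) 1) (+-monoˡ-≤ 1 x+q≤N)))
    y : ℕ
    y = a ∸ x
    N+1∸y≡x+q : N + 1 ∸ y ≡ x + q
    N+1∸y≡x+q = trans (cong (_∸ y) N+1≡a+q) ([m+n]∸[m∸o]≡o+n q (<⇒≤ x<a))

  Congruent⇒~ : ∀ {i j} → 1 ≤ i → i ≤ N → 1 ≤ j → j ≤ N → Congruent r (+ i) (+ j) → i ~ j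
  Congruent⇒~ {i} {j} 1≤i i≤N 1≤j j≤N i≡j =
    Step⇒~ (Step-gcd p q p+q≤N step-p step-q) 1≤i i≤N 1≤j j≤N
      (subst (_∣ ∣ i - j ∣ℕ) r≡gcd[p,q] (Congruent⇒∣∣m-n∣ i≡j))

  ≈⇒~ : ∀ {i j} → 1 ≤ i → i ≤ N → 1 ≤ j → j ≤ N → (+ i) ≈⟨ r , + c ⟩ (+ j) → i ~ j
  ≈⇒~ 1≤i i≤N 1≤j j≤N (straight i≡j) = Congruent⇒~ 1≤i i≤N 1≤j j≤N i≡j
  ≈⇒~ {i} 1≤i i≤N 1≤j j≤N (reflected i≡c-j) =
    etrans (gen1 i 1≤i i≤N)
      (Congruent⇒~ (m<n⇒0<n∸m (x<N+1 i≤N)) (N+1∸x≤N 1≤i) 1≤j j≤N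
        (Congruent-trans (reflect-sym (+ c) (reflect-N+1 i≤N)) (Congruent-sym (reflect-sym (+ c) i≡c-j))))

  r≤N : r ≤ N
  r≤N = ≤-trans (∣⇒≤ r∣p) (≤-trans (m≤m+n p q) p+q≤N)

  open Representatives r (+ c) N r≤N ~⇒≈ ≈⇒~ (proj₂ ∘ ~-positive) public

ClassStructure : ℕ → ℕ → ℕ → Set
ClassStructure m a b =
  let n = a + b
      r = gcd (a + 1 ∸ m) (b + 1 ∸ m)
      c = (+ m) -ℤ (+ 1)
  in ((i j : ℕ) → 1 ≤ i → i ≤ n ∸ m → 1 ≤ j → j ≤ n ∸ m →
        (Equiv m a n i j → ((+ i) ≡ (+ j) [mod r ]) ⊎ ((+ i) ≡ c -ℤ (+ j) [mod r ]))
      × (((+ i) ≡ (+ j) [mod r ]) ⊎ ((+ i) ≡ c -ℤ (+ j) [mod r ]) → Equiv m a n i j))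
   × ((i : ℕ) → 1 ≤ i → i ≤ n ∸ m →
        (¬ ((+ i) ≡ c -ℤ (+ i) [mod r ]) → TwoRepresentatives r (Equiv m a n) i)
      × ((+ i) ≡ c -ℤ (+ i) [mod r ] → UniqueRepresentative r (Equiv m a n) i))

ribbon-classes : ∀ m a b → 2 ≤ m → m ≤ a → m ≤ b → ClassStructure m a b
ribbon-classes (suc (suc k)) a b (s≤s (s≤s z≤n)) m≤a m≤b
  with m≤n⇒∃[o]m+o≡n m≤a | m≤n⇒∃[o]m+o≡n m≤b
... | a' , refl | b' , refl =
    (λ i j 1≤i i≤N 1≤j j≤N → ≈⇒⊎ ∘ ~⇒≈ , ≈⇒~ 1≤i i≤N 1≤j j≤N ∘ ⊎⇒≈)
  , (λ i 1≤i i≤N → (λ i≢c-i → two-representatives 1≤i i≤N (i≢c-i ∘ ≡[mod]))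
                 , unique-representative 1≤i i≤N ∘ congruent)
  where open Ribbon k a' b'

LastPartGe⇒≤∣∣c : ∀ {m α} → LastPartGe m α → m ≤ ∣ α ∣c
LastPartGe⇒≤∣∣c (αs , aₖ , refl , m≤aₖ) =
  subst (_ ≤_) (sym (sum-++ αs [ aₖ ]))
    (≤-trans m≤aₖ (≤-trans (m≤m+n aₖ 0) (m≤n+m (aₖ + 0) (sum αs))))

FirstPartGe⇒≤∣∣c : ∀ {m β} → FirstPartGe m β → m ≤ ∣ β ∣c
FirstPartGe⇒≤∣∣c (b₁ , βs , refl , m≤b₁) = ≤-trans m≤b₁ (m≤m+n b₁ (sum βs))

-- Only |α| and |β| matter.
lemma4p4 : (m : ℕ) → 2 ≤ m → (α β : List ℕ) →
    IsComposition α → IsComposition β → LastPartGe m α → FirstPartGe m β →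
    let a = ∣ α ∣c
        n = ∣ α ∣c + ∣ β ∣c
        r = gcd (a + 1 ∸ m) (∣ β ∣c + 1 ∸ m)
    in ((i j : ℕ) → 1 ≤ i → i ≤ n ∸ m → 1 ≤ j → j ≤ n ∸ m →
          (Equiv m a n i j
            → ((+ i) ≡ (+ j) [mod r ]) ⊎ ((+ i) ≡ ((+ m) -ℤ (+ 1)) -ℤ (+ j) [mod r ]))
          × (((+ i) ≡ (+ j) [mod r ]) ⊎ ((+ i) ≡ ((+ m) -ℤ (+ 1)) -ℤ (+ j) [mod r ])
            → Equiv m a n i j))
     × ((i : ℕ) → 1 ≤ i → i ≤ n ∸ m →
          (¬ ((+ i) ≡ ((+ m) -ℤ (+ 1)) -ℤ (+ i) [mod r ]) →
            Σ ℕ λ j → Σ ℕ λ k → ¬ (j ≡ k)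
              × (1 ≤ j) × (j ≤ r) × Equiv m a n i j
              × (1 ≤ k) × (k ≤ r) × Equiv m a n i k
              × ((l : ℕ) → 1 ≤ l → l ≤ r → Equiv m a n i l → (l ≡ j) ⊎ (l ≡ k)))
          × (((+ i) ≡ ((+ m) -ℤ (+ 1)) -ℤ (+ i) [mod r ]) →
            Σ ℕ λ j → (1 ≤ j) × (j ≤ r) × Equiv m a n i j
              × ((l : ℕ) → Equiv m a n i l → j ≤ l)
              × ((l : ℕ) → 1 ≤ l → l ≤ r → Equiv m a n i l → l ≡ j)))
lemma4p4 m 2≤m α β _ _ last first =
  ribbon-classes m ∣ α ∣c ∣ β ∣c 2≤m (LastPartGe⇒≤∣∣c last) (FirstPartGe⇒≤∣∣c first)
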